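{- For $1<R<2$, the following algorithm is $\max\{\frac{1}{R-1},2\}$-competitive for the general\&removable online knapsack problem with a buffer of capacity $R$: starting from $B_0=\emptyset$, in each round $i$ set $B_i=\emptyset$ and go through the items $e\in B_{i-1}\cup\{e_i\}$ in non-increasing order of density $v(e)/s(e)$, adding $e$ to $B_i$ whenever $s(B_i)+s(e)\le R$.
   Context: Online knapsack problem with a resource buffer: there is a knapsack of capacity $1$ and a buffer of capacity $R\ge 1$. Items $e_1,\dots,e_n$ arrive one by one; each item $e$ has size $0<s(e)\le 1$ and value $v(e)\ge 0$; $s(B),v(B)$ denote sums over a set $B$. A deterministic online algorithm maintains buffer contents $B_0=\emptyset,B_1,\dots,B_n$, with $B_i$ chosen after seeing only $e_1,\dots,e_i$, $B_i\subseteq B_{i-1}\cup\{e_i\}$ and $s(B_i)\le R$ (removable setting). $\mathrm{ALG}(I)=\max\{v(B)\mid B\subseteq B_n,\ s(B)\le 1\}$, $\mathrm{OPT}(I)=\max\{v(B)\mid B\subseteq\{e_1,\dots,e_n\},\ s(B)\le 1\}$. "General" means values are arbitrary. An algorithm is $c$-competitive if $\mathrm{OPT}(I)\le c\cdot\mathrm{ALG}(I)$ for every input $I$. Ties are broken arbitrarily.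
   Formalization: The buffer capacity $R$ and the item sizes $s(e)$ and values $v(e)$ are rational. -}

module Defs where

open import Data.Bool using (if_then_else_)
open import Data.List using (List; []; _∷_; _++_; [_]; map; foldr)
open import Data.List.Relation.Unary.Linked using (Linked)
open import Data.List.Relation.Binary.Permutation.Propositional using (_↭_)
open import Data.Product using (Σ; ∃; _×_; _,_)
open import Data.Rational using (ℚ; 0ℚ; 1ℚ; _+_; _-_; -_; _*_; _≤_; _<_; _≤ᵇ_; _⊔_; 1/_; >-nonZero; NonZero)
open import Data.Rational.Properties using (+-monoˡ-<; +-inverseʳ)
open import Relation.Binary.PropositionalEquality using (_≡_; subst)

record Item : Set where
  constructor item
  field
    s     : ℚ
    v     : ℚ
    s-pos : 0ℚ < s
    s≤1   : s ≤ 1ℚ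
    v≥0   : 0ℚ ≤ v
open Item public

density : Item → ℚ
density e = (v e * (1/ s e) {{>-nonZero (s-pos e)}})

sizeOf : List Item → ℚ
sizeOf = foldr (λ e acc → s e + acc) 0ℚ

valueOf : List Item → ℚ
valueOf = foldr (λ e acc → v e + acc) 0ℚ

subsets : {A : Set} → List A → List (List A)
subsets []       = [] ∷ []
subsets (x ∷ xs) = subsets xs ++ map (x ∷_) (subsets xs)

bestPacking : List Item → ℚ
bestPacking xs = foldr (λ B acc → (if sizeOf B ≤ᵇ 1ℚ then valueOf B else 0ℚ) ⊔ acc) 0ℚ (subsets xs)

-- OPT(I): items of the input; ALG(I): items of the final buffer B_n
OPT : List Item → ℚ
OPT = bestPacking

ALG : List Item → ℚ
ALG = bestPacking

greedyFrom : ℚ → List Item → List Item → List Item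
greedyFrom R B []       = B
greedyFrom R B (e ∷ es) =
  greedyFrom R (if sizeOf B + s e ≤ᵇ R then B ++ [ e ] else B) es

greedy : ℚ → List Item → List Item
greedy R = greedyFrom R []

DensityNonIncr : List Item → Set
DensityNonIncr = Linked (λ a b → density b ≤ density a)

-- One round: B' is obtained from B ∪ {e} by going through the items in some
-- non-increasing order of density (ties broken arbitrarily) greedily.
Step : ℚ → List Item → Item → List Item → Set
Step R B e B' =
  Σ (List Item) λ L → (L ↭ (B ++ [ e ])) × DensityNonIncr L × (B' ≡ greedy R L)

-- Run R I B : B is a possible final buffer B_n of the algorithm on input I
-- (items listed in arrival order), for some tie-breaking.
data Run (R : ℚ) : List Item → List Item → Set where
  start : Run R [] []
  step  : ∀ {I B e B'} → Run R I B → Step R B e B' → Run R (I ++ [ e ]) B'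

R-1>0 : ∀ {R} → 1ℚ < R → 0ℚ < R - 1ℚ
R-1>0 {R} 1<R = subst (_< R - 1ℚ) (+-inverseʳ 1ℚ) (+-monoˡ-< (- 1ℚ) 1<R)

ratio : (R : ℚ) → 1ℚ < R → ℚ
ratio R 1<R = (1/ (R - 1ℚ)) {{>-nonZero (R-1>0 1<R)}} ⊔ (1ℚ + 1ℚ)

module Submission where

-- For a price d ≥ 0 per unit of capacity let excess_d(e) = max(v(e) − d·s(e), 0). Pricing the
-- knapsack (LP duality for the fractional knapsack) gives OPT(I) ≤ Σ_I excess_d + d for all d ≥ 0.
-- Along the run we keep a threshold t such that Σ_I excess_d ≤ Σ_B excess_d for all d ≥ t, and
-- such that the items of B of density ≥ t have total size at least R − 1 (unless t = 0). A greedy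
-- round only drops items no denser than the first rejected item x; if t ≤ density(x), t is raised
-- to density(x), and then the accepted prefix has size > R − s(x) ≥ R − 1.
-- At the end, split B at the first item x that overflows the knapsack, with prefix P. If
-- t ≤ density(x), pricing at density(x) bounds OPT by v(P) + v(x) ≤ 2·ALG. Otherwise
-- Σ_P excess_t + t·M ≤ v(P), where M ≥ R − 1 is the size of the items of P of density ≥ t,
-- so OPT ≤ Σ_P excess_t + t ≤ max{1/(R − 1), 1}·v(P).

open import Defs
open import Algebra.Bundles using (CommutativeMonoid)
import Algebra.Properties.CommutativeSemigroup as CommSemigroupProperties
open import Data.Bool using (true; false; if_then_else_)
open import Data.Empty using (⊥-elim)
open import Data.List using (List; []; _∷_; _++_; [_]; foldr)
open import Data.List.Properties using (++-assoc; ++-identityʳ)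
open import Data.List.Membership.Propositional using (_∈_)
open import Data.List.Membership.Propositional.Properties using (∈-++⁺ˡ; ∈-++⁺ʳ; ∈-map⁺)
open import Data.List.Relation.Unary.All as All using (All; []; _∷_)
import Data.List.Relation.Unary.All.Properties as All
open import Data.List.Relation.Unary.AllPairs using (AllPairs; []; _∷_)
open import Data.List.Relation.Unary.Any using (here; there)
open import Data.List.Relation.Unary.Linked.Properties using (Linked⇒AllPairs)
open import Data.List.Relation.Binary.Permutation.Propositional as ↭ using (_↭_)
open import Data.List.Relation.Binary.Sublist.Propositional
  using (_⊆_; []; _∷_; _∷ʳ_; ⊆-refl; minimum)
open import Data.List.Relation.Binary.Sublist.Propositional.Properties
  using (All-resp-⊆; ++⁺ˡ; ++⁺ʳ)
open import Data.Product using (∃; _×_; _,_)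
open import Data.Rational
  using (ℚ; 0ℚ; 1ℚ; _+_; _-_; -_; _*_; _≤_; _<_; _≤ᵇ_; _⊔_; 1/_; >-nonZero; nonNegative; positive)
open import Data.Rational.Properties
open import Relation.Binary.PropositionalEquality
  using (_≡_; refl; sym; trans; cong; cong₂; subst; module ≡-Reasoning)
open import Relation.Nullary using (Dec; yes; no)

private
  module +-CS = CommSemigroupProperties
    (CommutativeMonoid.commutativeSemigroup +-0-commutativeMonoid)
  module *-CS = CommSemigroupProperties
    (CommutativeMonoid.commutativeSemigroup *-1-commutativeMonoid)

0≤1 : 0ℚ ≤ 1ℚ
0≤1 = <⇒≤ (positive⁻¹ 1ℚ)

*-monoˡ-≤-nonNeg′ : ∀ {r p q} → 0ℚ ≤ r → p ≤ q → r * p ≤ r * q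
*-monoˡ-≤-nonNeg′ {r} 0≤r = *-monoˡ-≤-nonNeg r {{nonNegative 0≤r}}

*-monoʳ-≤-nonNeg′ : ∀ {r p q} → 0ℚ ≤ r → p ≤ q → p * r ≤ q * r
*-monoʳ-≤-nonNeg′ {r} 0≤r = *-monoʳ-≤-nonNeg r {{nonNegative 0≤r}}

*-nonNeg : ∀ {p q} → 0ℚ ≤ p → 0ℚ ≤ q → 0ℚ ≤ p * q
*-nonNeg {p} {q} 0≤p 0≤q = subst (_≤ p * q) (*-zeroʳ p) (*-monoˡ-≤-nonNeg′ 0≤p 0≤q)

p≤p+q : ∀ {p q} → 0ℚ ≤ q → p ≤ p + q
p≤p+q {p} {q} 0≤q = subst (_≤ p + q) (+-identityʳ p) (+-monoʳ-≤ p 0≤q)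

p≤q+p : ∀ {p q} → 0ℚ ≤ q → p ≤ q + p
p≤q+p {p} {q} 0≤q = subst (p ≤_) (+-comm p q) (p≤p+q 0≤q)

p≤c*p : ∀ {c p} → 1ℚ ≤ c → 0ℚ ≤ p → p ≤ c * p
p≤c*p {c} {p} 1≤c 0≤p = subst (_≤ c * p) (*-identityˡ p) (*-monoʳ-≤-nonNeg′ 0≤p 1≤c)

p-q+q≡p : ∀ p q → p - q + q ≡ p
p-q+q≡p p q = trans (+-assoc p (- q) q) (trans (cong (p +_) (+-inverseˡ q)) (+-identityʳ p))

q+[p-q]≡p : ∀ p q → q + (p - q) ≡ p
q+[p-q]≡p p q = trans (+-comm q (p - q)) (p-q+q≡p p q)

p≤q⇒0≤q-p : ∀ {p q} → p ≤ q → 0ℚ ≤ q - p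
p≤q⇒0≤q-p {p} {q} p≤q = subst (_≤ q - p) (+-inverseʳ p) (+-monoˡ-≤ (- p) p≤q)

p≤q-r⇒r+p≤q : ∀ {p q r} → p ≤ q - r → r + p ≤ q
p≤q-r⇒r+p≤q {p} {q} {r} h = subst (r + p ≤_) (q+[p-q]≡p q r) (+-monoʳ-≤ r h)

q-r<p⇒q<r+p : ∀ {p q r} → q - r < p → q < r + p
q-r<p⇒q<r+p {p} {q} {r} h = subst (_< r + p) (q+[p-q]≡p q r) (+-monoʳ-< r h)

p≤q+r⇒p-r≤q : ∀ {p q r} → p ≤ q + r → p - r ≤ q
p≤q+r⇒p-r≤q {p} {q} {r} h = begin
  p - r        ≤⟨ +-monoˡ-≤ (- r) h ⟩
  q + r - r    ≡⟨ +-assoc q r (- r) ⟩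
  q + (r - r)  ≡⟨ cong (q +_) (+-inverseʳ r) ⟩
  q + 0ℚ       ≡⟨ +-identityʳ q ⟩
  q            ∎
  where open ≤-Reasoning

sumOf : {A : Set} → (A → ℚ) → List A → ℚ
sumOf f = foldr (λ a acc → f a + acc) 0ℚ

module _ {A : Set} (f : A → ℚ) where

  sumOf-++ : ∀ xs ys → sumOf f (xs ++ ys) ≡ sumOf f xs + sumOf f ys
  sumOf-++ []       ys = sym (+-identityˡ (sumOf f ys))
  sumOf-++ (x ∷ xs) ys =
    trans (cong (f x +_) (sumOf-++ xs ys)) (sym (+-assoc (f x) (sumOf f xs) (sumOf f ys)))

  sumOf-↭ : ∀ {xs ys} → xs ↭ ys → sumOf f xs ≡ sumOf f ys
  sumOf-↭ ↭.refl         = refl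
  sumOf-↭ (↭.prep x p)   = cong (f x +_) (sumOf-↭ p)
  sumOf-↭ (↭.swap x y p) =
    trans (cong (λ r → f x + (f y + r)) (sumOf-↭ p)) (+-CS.x∙yz≈y∙xz (f x) (f y) _)
  sumOf-↭ (↭.trans p q)  = trans (sumOf-↭ p) (sumOf-↭ q)

  sumOf-⊆ : (∀ a → 0ℚ ≤ f a) → ∀ {xs ys} → xs ⊆ ys → sumOf f xs ≤ sumOf f ys
  sumOf-⊆ 0≤f []                       = ≤-refl
  sumOf-⊆ 0≤f (y ∷ʳ xs⊆ys)             = ≤-trans (sumOf-⊆ 0≤f xs⊆ys) (p≤q+p (0≤f y))
  sumOf-⊆ 0≤f (_∷_ {x = x} refl xs⊆ys) = +-monoʳ-≤ (f x) (sumOf-⊆ 0≤f xs⊆ys)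

  sumOf-nonNeg : (∀ a → 0ℚ ≤ f a) → ∀ xs → 0ℚ ≤ sumOf f xs
  sumOf-nonNeg 0≤f xs = sumOf-⊆ 0≤f (minimum xs)

  sumOf-++-nonNeg : (∀ a → 0ℚ ≤ f a) → ∀ xs ys → sumOf f xs ≤ sumOf f (xs ++ ys)
  sumOf-++-nonNeg 0≤f xs ys = sumOf-⊆ 0≤f {xs} (++⁺ʳ ys ⊆-refl)

  sumOf-nonPos : ∀ {xs} → All (λ a → f a ≤ 0ℚ) xs → sumOf f xs ≤ 0ℚ
  sumOf-nonPos []                    = ≤-refl
  sumOf-nonPos {x ∷ xs} (fx≤0 ∷ h) =
    subst (f x + sumOf f xs ≤_) (+-identityʳ 0ℚ) (+-mono-≤ fx≤0 (sumOf-nonPos h))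

  sumOf-++-nonPos : ∀ xs {ys} → All (λ a → f a ≤ 0ℚ) ys → sumOf f (xs ++ ys) ≤ sumOf f xs
  sumOf-++-nonPos xs {ys} h = begin
    sumOf f (xs ++ ys)       ≡⟨ sumOf-++ xs ys ⟩
    sumOf f xs + sumOf f ys  ≤⟨ +-monoʳ-≤ (sumOf f xs) (sumOf-nonPos h) ⟩
    sumOf f xs + 0ℚ          ≡⟨ +-identityʳ (sumOf f xs) ⟩
    sumOf f xs               ∎
    where open ≤-Reasoning

module _ {A : Set} where

  sumOf-mono : ∀ {f g : A → ℚ} {xs} → All (λ a → f a ≤ g a) xs → sumOf f xs ≤ sumOf g xs
  sumOf-mono []          = ≤-refl
  sumOf-mono (fx≤gx ∷ h) = +-mono-≤ fx≤gx (sumOf-mono h)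

  sumOf-linear : ∀ (f g : A → ℚ) d xs →
                 sumOf (λ a → f a + d * g a) xs ≡ sumOf f xs + d * sumOf g xs
  sumOf-linear f g d []       = sym (trans (+-identityˡ (d * 0ℚ)) (*-zeroʳ d))
  sumOf-linear f g d (x ∷ xs) = begin
    f x + d * g x + sumOf (λ a → f a + d * g a) xs  ≡⟨ cong (f x + d * g x +_) (sumOf-linear f g d xs) ⟩
    f x + d * g x + (sumOf f xs + d * sumOf g xs)   ≡⟨ +-CS.interchange (f x) (d * g x) (sumOf f xs) _ ⟩
    f x + sumOf f xs + (d * g x + d * sumOf g xs)   ≡⟨ cong (f x + sumOf f xs +_)
                                                           (*-distribˡ-+ d (g x) (sumOf g xs)) ⟨
    f x + sumOf f xs + d * (g x + sumOf g xs)       ∎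
    where open ≡-Reasoning

maxOf : {A : Set} → (A → ℚ) → List A → ℚ
maxOf g = foldr (λ a acc → g a ⊔ acc) 0ℚ

module _ {A : Set} (g : A → ℚ) where

  maxOf-upper : ∀ {a xs} → a ∈ xs → g a ≤ maxOf g xs
  maxOf-upper {xs = x ∷ xs} (here refl)  = p≤p⊔q (g x) (maxOf g xs)
  maxOf-upper {xs = x ∷ xs} (there a∈xs) = ≤-trans (maxOf-upper a∈xs) (p≤q⊔p (g x) (maxOf g xs))

  maxOf-lub : ∀ {X xs} → 0ℚ ≤ X → All (λ a → g a ≤ X) xs → maxOf g xs ≤ X
  maxOf-lub 0≤X []         = 0≤X
  maxOf-lub 0≤X (gx≤X ∷ h) = ⊔-lub gx≤X (maxOf-lub 0≤X h)

subsets-⊆ : {A : Set} (xs : List A) → All (_⊆ xs) (subsets xs)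
subsets-⊆ []       = [] ∷ []
subsets-⊆ (x ∷ xs) =
  All.++⁺ (All.map (x ∷ʳ_) (subsets-⊆ xs)) (All.map⁺ (All.map (refl ∷_) (subsets-⊆ xs)))

⊆⇒∈subsets : {A : Set} {ys xs : List A} → ys ⊆ xs → ys ∈ subsets xs
⊆⇒∈subsets []                          = here refl
⊆⇒∈subsets (x ∷ʳ ys⊆xs)                 = ∈-++⁺ˡ (⊆⇒∈subsets ys⊆xs)
⊆⇒∈subsets {xs = x ∷ xs} (refl ∷ ys⊆xs) =
  ∈-++⁺ʳ (subsets xs) (∈-map⁺ (x ∷_) (⊆⇒∈subsets ys⊆xs))

packingValue : List Item → ℚ
packingValue C = if sizeOf C ≤ᵇ 1ℚ then valueOf C else 0ℚ

valueOf≤bestPacking : ∀ C {xs} → C ⊆ xs → sizeOf C ≤ 1ℚ → valueOf C ≤ bestPacking xs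
valueOf≤bestPacking C {xs} C⊆xs C-fits =
  subst (_≤ bestPacking xs) packingValue≡valueOf (maxOf-upper packingValue (⊆⇒∈subsets C⊆xs))
  where
  packingValue≡valueOf : packingValue C ≡ valueOf C
  packingValue≡valueOf with sizeOf C ≤ᵇ 1ℚ | ≤⇒≤ᵇ C-fits
  ... | true | _ = refl

bestPacking-lub : ∀ {X} xs → 0ℚ ≤ X → (∀ {C} → C ⊆ xs → sizeOf C ≤ 1ℚ → valueOf C ≤ X) →
                  bestPacking xs ≤ X
bestPacking-lub {X} xs 0≤X bound =
  maxOf-lub packingValue 0≤X (All.map packingValue≤X (subsets-⊆ xs))
  where
  packingValue≤X : ∀ {C} → C ⊆ xs → packingValue C ≤ X
  packingValue≤X {C} C⊆xs with sizeOf C ≤ᵇ 1ℚ | ≤ᵇ⇒≤ {sizeOf C} {1ℚ}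
  ... | true  | C-fits = bound C⊆xs (C-fits _)
  ... | false | _      = 0≤X

-- Excess over a price

s-nonNeg : ∀ e → 0ℚ ≤ s e
s-nonNeg e = <⇒≤ (s-pos e)

density*s≡v : ∀ e → density e * s e ≡ v e
density*s≡v e = trans (*-assoc (v e) _ (s e))
  (trans (cong (v e *_) (*-inverseˡ (s e) {{>-nonZero (s-pos e)}})) (*-identityʳ (v e)))

density-nonNeg : ∀ e → 0ℚ ≤ density e
density-nonNeg e =
  *-nonNeg (v≥0 e) (<⇒≤ (positive⁻¹ _ {{1/pos⇒pos (s e) {{positive (s-pos e)}}}}))

excess : ℚ → Item → ℚ
excess d e = (v e - d * s e) ⊔ 0ℚ

denseSize : ℚ → Item → ℚ
denseSize d e with d ≤? density e
... | yes _ = s e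
... | no  _ = 0ℚ

excess-nonNeg : ∀ d e → 0ℚ ≤ excess d e
excess-nonNeg d e = p≤q⊔p (v e - d * s e) 0ℚ

excess≤0 : ∀ {d} e → density e ≤ d → excess d e ≤ 0ℚ
excess≤0 {d} e e≤d = ⊔-lub v-ds≤0 ≤-refl
  where
  v-ds≤0 : v e - d * s e ≤ 0ℚ
  v-ds≤0 = begin
    v e - d * s e              ≡⟨ cong (_- d * s e) (density*s≡v e) ⟨
    density e * s e - d * s e  ≤⟨ +-monoˡ-≤ (- (d * s e)) (*-monoʳ-≤-nonNeg′ (s-nonNeg e) e≤d) ⟩
    d * s e - d * s e          ≡⟨ +-inverseʳ (d * s e) ⟩
    0ℚ                         ∎
    where open ≤-Reasoning

v≤excess+d*s : ∀ d e → v e ≤ excess d e + d * s e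
v≤excess+d*s d e = subst (_≤ excess d e + d * s e) (p-q+q≡p (v e) (d * s e))
  (+-monoˡ-≤ (d * s e) (p≤p⊔q (v e - d * s e) 0ℚ))

excess+d*s≤v : ∀ {d} e → d ≤ density e → excess d e + d * s e ≤ v e
excess+d*s≤v {d} e d≤e = subst (excess d e + d * s e ≤_) (p-q+q≡p (v e) (d * s e))
  (+-monoˡ-≤ (d * s e) (⊔-lub ≤-refl (p≤q⇒0≤q-p ds≤v)))
  where
  ds≤v : d * s e ≤ v e
  ds≤v = subst (d * s e ≤_) (density*s≡v e) (*-monoʳ-≤-nonNeg′ (s-nonNeg e) d≤e)

denseSize-nonNeg : ∀ d e → 0ℚ ≤ denseSize d e
denseSize-nonNeg d e with d ≤? density e
... | yes _ = s-nonNeg e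
... | no  _ = ≤-refl

denseSize≤0 : ∀ {d} e → density e < d → denseSize d e ≤ 0ℚ
denseSize≤0 {d} e e<d with d ≤? density e
... | yes d≤e = ⊥-elim (<-irrefl refl (<-≤-trans e<d d≤e))
... | no  _   = ≤-refl

s≤denseSize : ∀ {d} e → d ≤ density e → s e ≤ denseSize d e
s≤denseSize {d} e d≤e with d ≤? density e
... | yes _   = ≤-refl
... | no  d≰e = ⊥-elim (d≰e d≤e)

excess+d*denseSize≤v : ∀ {d} e → 0ℚ ≤ d → excess d e + d * denseSize d e ≤ v e
excess+d*denseSize≤v {d} e 0≤d with d ≤? density e
... | yes d≤e = excess+d*s≤v e d≤e
... | no  d≰e = begin
  excess d e + d * 0ℚ  ≡⟨ cong (excess d e +_) (*-zeroʳ d) ⟩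
  excess d e + 0ℚ      ≡⟨ +-identityʳ (excess d e) ⟩
  excess d e           ≤⟨ excess≤0 e (<⇒≤ (≰⇒> d≰e)) ⟩
  0ℚ                   ≤⟨ v≥0 e ⟩
  v e                  ∎
  where open ≤-Reasoning

valueOf≤excess+d*size : ∀ d C → valueOf C ≤ sumOf (excess d) C + d * sizeOf C
valueOf≤excess+d*size d C = subst (valueOf C ≤_) (sumOf-linear (excess d) s d C)
  (sumOf-mono (All.universal (v≤excess+d*s d) C))

excess+d*size≤valueOf : ∀ {d P} → All (λ e → d ≤ density e) P →
                        sumOf (excess d) P + d * sizeOf P ≤ valueOf P
excess+d*size≤valueOf {d} {P} h = subst (_≤ valueOf P) (sumOf-linear (excess d) s d P)
  (sumOf-mono (All.map (λ {e} → excess+d*s≤v e) h))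

excess+d*denseSize≤valueOf : ∀ {d} P → 0ℚ ≤ d →
                             sumOf (excess d) P + d * sumOf (denseSize d) P ≤ valueOf P
excess+d*denseSize≤valueOf {d} P 0≤d =
  subst (_≤ valueOf P) (sumOf-linear (excess d) (denseSize d) d P)
    (sumOf-mono (All.universal (λ e → excess+d*denseSize≤v e 0≤d) P))

bestPacking≤excess+d : ∀ {d} I → 0ℚ ≤ d → bestPacking I ≤ sumOf (excess d) I + d
bestPacking≤excess+d {d} I 0≤d =
  bestPacking-lub I (≤-trans (sumOf-nonNeg (excess d) (excess-nonNeg d) I) (p≤p+q 0≤d)) packing≤
  where
  packing≤ : ∀ {C} → C ⊆ I → sizeOf C ≤ 1ℚ → valueOf C ≤ sumOf (excess d) I + d
  packing≤ {C} C⊆I C-fits = begin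
    valueOf C                          ≤⟨ valueOf≤excess+d*size d C ⟩
    sumOf (excess d) C + d * sizeOf C  ≤⟨ +-mono-≤ (sumOf-⊆ (excess d) (excess-nonNeg d) C⊆I)
                                                   (*-monoˡ-≤-nonNeg′ 0≤d C-fits) ⟩
    sumOf (excess d) I + d * 1ℚ        ≡⟨ cong (sumOf (excess d) I +_) (*-identityʳ d) ⟩
    sumOf (excess d) I + d             ∎
    where open ≤-Reasoning

data Overflow {A : Set} (f : A → ℚ) (C : ℚ) : List A → Set where
  fits      : ∀ {xs} → sumOf f xs ≤ C → Overflow f C xs
  overflows : ∀ P x Q → sumOf f P ≤ C → C < sumOf f P + f x → Overflow f C (P ++ x ∷ Q)

overflow : {A : Set} (f : A → ℚ) {C : ℚ} → 0ℚ ≤ C → ∀ xs → Overflow f C xs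
overflow f 0≤C [] = fits 0≤C
overflow f {C} 0≤C (y ∷ xs) with C <? f y
... | yes C<fy = overflows [] y xs 0≤C (subst (C <_) (sym (+-identityˡ (f y))) C<fy)
... | no  C≮fy with overflow f (p≤q⇒0≤q-p (≮⇒≥ C≮fy)) xs
...   | fits h                = fits (p≤q-r⇒r+p≤q h)
...   | overflows P x Q h₁ h₂ = overflows (y ∷ P) x Q (p≤q-r⇒r+p≤q h₁)
  (subst (C <_) (sym (+-assoc (f y) (sumOf f P) (f x))) (q-r<p⇒q<r+p h₂))

greedyFrom-accept : ∀ {R acc e} L → sizeOf acc + s e ≤ R →
                    greedyFrom R acc (e ∷ L) ≡ greedyFrom R (acc ++ [ e ]) L
greedyFrom-accept {R} {acc} {e} L e-fits with sizeOf acc + s e ≤ᵇ R | ≤⇒≤ᵇ e-fits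
... | true | _ = refl

greedyFrom-reject : ∀ {R acc e} L → R < sizeOf acc + s e →
                    greedyFrom R acc (e ∷ L) ≡ greedyFrom R acc L
greedyFrom-reject {R} {acc} {e} L R< with sizeOf acc + s e ≤ᵇ R | ≤ᵇ⇒≤ {sizeOf acc + s e} {R}
... | true  | e-fits = ⊥-elim (<-irrefl refl (<-≤-trans R< (e-fits _)))
... | false | _      = refl

greedyFrom-⊆ : ∀ R acc L → ∃ λ K → K ⊆ L × greedyFrom R acc L ≡ acc ++ K
greedyFrom-⊆ R acc [] = [] , [] , sym (++-identityʳ acc)
greedyFrom-⊆ R acc (e ∷ L) with sizeOf acc + s e ≤ᵇ R
... | true with greedyFrom-⊆ R (acc ++ [ e ]) L
...   | K , K⊆L , eq = e ∷ K , refl ∷ K⊆L , trans eq (++-assoc acc [ e ] K)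
greedyFrom-⊆ R acc (e ∷ L) | false with greedyFrom-⊆ R acc L
...   | K , K⊆L , eq = K , e ∷ʳ K⊆L , eq

greedyFrom-fits : ∀ R acc P L → sizeOf (acc ++ P) ≤ R →
                  greedyFrom R acc (P ++ L) ≡ greedyFrom R (acc ++ P) L
greedyFrom-fits R acc []      L _      = cong (λ B → greedyFrom R B L) (sym (++-identityʳ acc))
greedyFrom-fits R acc (e ∷ P) L P-fits = begin
  greedyFrom R acc (e ∷ P ++ L)         ≡⟨ greedyFrom-accept (P ++ L) e-fits ⟩
  greedyFrom R (acc ++ [ e ]) (P ++ L)  ≡⟨ greedyFrom-fits R (acc ++ [ e ]) P L
                                             (subst (λ B → sizeOf B ≤ R) (sym assoc) P-fits) ⟩
  greedyFrom R ((acc ++ [ e ]) ++ P) L  ≡⟨ cong (λ B → greedyFrom R B L) assoc ⟩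
  greedyFrom R (acc ++ e ∷ P) L         ∎
  where
  open ≡-Reasoning
  assoc : (acc ++ [ e ]) ++ P ≡ acc ++ e ∷ P
  assoc = ++-assoc acc [ e ] P
  e-fits : sizeOf acc + s e ≤ R
  e-fits = ≤-trans (+-monoʳ-≤ (sizeOf acc) (p≤p+q (sumOf-nonNeg s s-nonNeg P)))
                   (subst (_≤ R) (sumOf-++ s acc (e ∷ P)) P-fits)

greedy-fits : ∀ R L → sizeOf L ≤ R → greedy R L ≡ L
greedy-fits R L L-fits =
  trans (cong (greedyFrom R []) (sym (++-identityʳ L))) (greedyFrom-fits R [] L [] L-fits)

greedy-overflow : ∀ R P x Q → sizeOf P ≤ R → R < sizeOf P + s x →
                  ∃ λ K → K ⊆ Q × greedy R (P ++ x ∷ Q) ≡ P ++ K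
greedy-overflow R P x Q P-fits x-rejected with greedyFrom-⊆ R P Q
... | K , K⊆Q , eq = K , K⊆Q , (begin
  greedyFrom R [] (P ++ x ∷ Q)  ≡⟨ greedyFrom-fits R [] P (x ∷ Q) P-fits ⟩
  greedyFrom R P (x ∷ Q)        ≡⟨ greedyFrom-reject Q x-rejected ⟩
  greedyFrom R P Q              ≡⟨ eq ⟩
  P ++ K                        ∎)
  where open ≡-Reasoning

DensitySorted : List Item → Set
DensitySorted = AllPairs (λ a b → density b ≤ density a)

AllPairs-resp-⊆ : {A : Set} {R : A → A → Set} {xs ys : List A} →
                  xs ⊆ ys → AllPairs R ys → AllPairs R xs
AllPairs-resp-⊆ []             []       = []
AllPairs-resp-⊆ (y ∷ʳ xs⊆ys)   (_ ∷ h)  = AllPairs-resp-⊆ xs⊆ys h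
AllPairs-resp-⊆ (refl ∷ xs⊆ys) (px ∷ h) = All-resp-⊆ xs⊆ys px ∷ AllPairs-resp-⊆ xs⊆ys h

AllPairs-pivot : {A : Set} {R : A → A → Set} (P : List A) {x : A} {Q : List A} →
                 AllPairs R (P ++ x ∷ Q) → All (λ a → R a x) P × All (R x) Q
AllPairs-pivot []      (x-Q ∷ _)   = [] , x-Q
AllPairs-pivot (p ∷ P) (p-PxQ ∷ h) with AllPairs-pivot P h | All.++⁻ʳ P p-PxQ
... | P-x , x-Q | p-x ∷ _ = p-x ∷ P-x , x-Q

linked⇒sorted : ∀ {L} → DensityNonIncr L → DensitySorted L
linked⇒sorted = Linked⇒AllPairs (λ b≤a c≤b → ≤-trans c≤b b≤a)

run-sorted : ∀ {R I B} → Run R I B → DensitySorted B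
run-sorted start = []
run-sorted {R} (step _ (L , _ , L-sorted , refl)) with greedyFrom-⊆ R [] L
... | K , K⊆L , eq rewrite eq = AllPairs-resp-⊆ K⊆L (linked⇒sorted L-sorted)

-- The invariant

record Certificate (R : ℚ) (I B : List Item) : Set where
  field
    threshold   : ℚ
    0≤threshold : 0ℚ ≤ threshold
    dominates   : ∀ {d} → threshold ≤ d → sumOf (excess d) I ≤ sumOf (excess d) B
    -- Scaled by the threshold, so that it holds vacuously while the threshold is 0.
    saturated   : threshold * (R - 1ℚ) ≤ threshold * sumOf (denseSize threshold) B

certificate-start : ∀ {R} → Certificate R [] []
certificate-start {R} = record
  { threshold   = 0ℚ
  ; 0≤threshold = ≤-refl
  ; dominates   = λ _ → ≤-refl
  ; saturated   = ≤-reflexive (trans (*-zeroˡ (R - 1ℚ)) (sym (*-zeroˡ 0ℚ)))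
  }

certificate-append : ∀ {R I B e L} → Certificate R I B → L ↭ B ++ [ e ] →
                     Certificate R (I ++ [ e ]) L
certificate-append {R} {I} {B} {e} {L} cert L↭ = record
  { threshold   = threshold
  ; 0≤threshold = 0≤threshold
  ; dominates   = dominates′
  ; saturated   = ≤-trans saturated (*-monoˡ-≤-nonNeg′ 0≤threshold (begin
      sumOf (denseSize threshold) B             ≤⟨ sumOf-++-nonNeg (denseSize threshold)
                                                     (denseSize-nonNeg threshold) B [ e ] ⟩
      sumOf (denseSize threshold) (B ++ [ e ])  ≡⟨ sumOf-↭ (denseSize threshold) L↭ ⟨
      sumOf (denseSize threshold) L             ∎))
  }
  where
  open Certificate cert
  open ≤-Reasoning
  dominates′ : ∀ {d} → threshold ≤ d → sumOf (excess d) (I ++ [ e ]) ≤ sumOf (excess d) L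
  dominates′ {d} t≤d = begin
    sumOf (excess d) (I ++ [ e ])                ≡⟨ sumOf-++ (excess d) I [ e ] ⟩
    sumOf (excess d) I + sumOf (excess d) [ e ]  ≤⟨ +-monoˡ-≤ (sumOf (excess d) [ e ]) (dominates t≤d) ⟩
    sumOf (excess d) B + sumOf (excess d) [ e ]  ≡⟨ sumOf-++ (excess d) B [ e ] ⟨
    sumOf (excess d) (B ++ [ e ])                ≡⟨ sumOf-↭ (excess d) L↭ ⟨
    sumOf (excess d) L                           ∎

certificate-prune : ∀ {R I} P x Q {K} → K ⊆ Q → DensitySorted (P ++ x ∷ Q) → R - 1ℚ ≤ sizeOf P →
                    Certificate R I (P ++ x ∷ Q) → Certificate R I (P ++ K)
certificate-prune {R} {I} P x Q {K} K⊆Q sorted P-large cert with AllPairs-pivot P sorted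
... | above , below = pruned (threshold ≤? density x)
  where
  open Certificate cert
  open ≤-Reasoning

  drop-tail : ∀ {f} → (∀ e → 0ℚ ≤ f e) → (∀ {e} → density e ≤ density x → f e ≤ 0ℚ) →
              sumOf f (P ++ x ∷ Q) ≤ sumOf f (P ++ K)
  drop-tail {f} 0≤f f≤0 = ≤-trans (sumOf-++-nonPos f P (All.map f≤0 (≤-refl ∷ below)))
                                  (sumOf-++-nonNeg f 0≤f P K)

  dominates′ : ∀ {d} → threshold ≤ d → density x ≤ d →
               sumOf (excess d) I ≤ sumOf (excess d) (P ++ K)
  dominates′ {d} t≤d x≤d = ≤-trans (dominates t≤d)
    (drop-tail (excess-nonNeg d) (λ {e} e≤x → excess≤0 e (≤-trans e≤x x≤d)))

  pruned : Dec (threshold ≤ density x) → Certificate R I (P ++ K)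
  pruned (yes t≤x) = record
    { threshold   = density x
    ; 0≤threshold = density-nonNeg x
    ; dominates   = λ x≤d → dominates′ (≤-trans t≤x x≤d) x≤d
    ; saturated   = *-monoˡ-≤-nonNeg′ (density-nonNeg x) (begin
        R - 1ℚ                                  ≤⟨ P-large ⟩
        sizeOf P                                ≤⟨ sumOf-mono (All.map (λ {e} → s≤denseSize e) above) ⟩
        sumOf (denseSize (density x)) P         ≤⟨ sumOf-++-nonNeg (denseSize (density x))
                                                     (denseSize-nonNeg (density x)) P K ⟩
        sumOf (denseSize (density x)) (P ++ K)  ∎)
    }
  pruned (no t≰x) = record
    { threshold   = threshold
    ; 0≤threshold = 0≤threshold
    ; dominates   = λ t≤d → dominates′ t≤d (≤-trans (<⇒≤ x<t) t≤d)
    ; saturated   = ≤-trans saturated (*-monoˡ-≤-nonNeg′ 0≤threshold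
        (drop-tail (denseSize-nonNeg threshold) (λ {e} e≤x → denseSize≤0 e (≤-<-trans e≤x x<t))))
    }
    where
    x<t : density x < threshold
    x<t = ≰⇒> t≰x

certificate-greedy : ∀ {R I L} → 1ℚ < R → DensitySorted L → Certificate R I L →
                     Certificate R I (greedy R L)
certificate-greedy {R} {I} {L} 1<R sorted cert with overflow s (≤-trans 0≤1 (<⇒≤ 1<R)) L
... | fits L-fits rewrite greedy-fits R L L-fits = cert
... | overflows P x Q P-fits x-rejected with greedy-overflow R P x Q P-fits x-rejected
...   | K , K⊆Q , eq rewrite eq = certificate-prune P x Q K⊆Q sorted P-large cert
  where
  P-large : R - 1ℚ ≤ sizeOf P
  P-large = p≤q+r⇒p-r≤q (≤-trans (<⇒≤ x-rejected) (+-monoʳ-≤ (sizeOf P) (s≤1 x)))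

certificate-run : ∀ {R I B} → 1ℚ < R → Run R I B → Certificate R I B
certificate-run 1<R start = certificate-start
certificate-run 1<R (step run (L , L↭ , L-sorted , refl)) =
  certificate-greedy 1<R (linked⇒sorted L-sorted) (certificate-append (certificate-run 1<R run) L↭)

-- Competitiveness

certificate-OPT≤ : ∀ {R I B d} (cert : Certificate R I B) → Certificate.threshold cert ≤ d →
                   OPT I ≤ sumOf (excess d) B + d
certificate-OPT≤ {I = I} {B} {d} cert t≤d =
  ≤-trans (bestPacking≤excess+d I (≤-trans 0≤threshold t≤d)) (+-monoˡ-≤ d (dominates t≤d))
  where open Certificate cert

module Competitive {R c : ℚ} (2≤c : 1ℚ + 1ℚ ≤ c) (1≤c[R-1] : 1ℚ ≤ c * (R - 1ℚ)) where

  1≤c : 1ℚ ≤ c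
  1≤c = ≤-trans (p≤p+q 0≤1) 2≤c

  0≤c : 0ℚ ≤ c
  0≤c = ≤-trans 0≤1 1≤c

  p+q≤c*r : ∀ {p q r} → 0ℚ ≤ r → p ≤ r → q ≤ r → p + q ≤ c * r
  p+q≤c*r {p} {q} {r} 0≤r p≤r q≤r = begin
    p + q            ≤⟨ +-mono-≤ p≤r q≤r ⟩
    r + r            ≡⟨ cong₂ _+_ (*-identityˡ r) (*-identityˡ r) ⟨
    1ℚ * r + 1ℚ * r  ≡⟨ *-distribʳ-+ r 1ℚ 1ℚ ⟨
    (1ℚ + 1ℚ) * r    ≤⟨ *-monoʳ-≤-nonNeg′ 0≤r 2≤c ⟩
    c * r            ∎
    where open ≤-Reasoning

  saturated-bound : ∀ {d} P → 0ℚ ≤ d → d * (R - 1ℚ) ≤ d * sumOf (denseSize d) P →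
                    sumOf (excess d) P + d ≤ c * valueOf P
  saturated-bound {d} P 0≤d saturated = begin
    X + d                ≤⟨ +-mono-≤ (p≤c*p 1≤c (sumOf-nonNeg (excess d) (excess-nonNeg d) P)) d≤c*dM ⟩
    c * X + c * (d * M)  ≡⟨ *-distribˡ-+ c X (d * M) ⟨
    c * (X + d * M)      ≤⟨ *-monoˡ-≤-nonNeg′ 0≤c (excess+d*denseSize≤valueOf P 0≤d) ⟩
    c * valueOf P        ∎
    where
    open ≤-Reasoning
    X = sumOf (excess d) P
    M = sumOf (denseSize d) P
    d≤c*dM : d ≤ c * (d * M)
    d≤c*dM = begin
      d                   ≡⟨ *-identityʳ d ⟨
      d * 1ℚ              ≤⟨ *-monoˡ-≤-nonNeg′ 0≤d 1≤c[R-1] ⟩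
      d * (c * (R - 1ℚ))  ≡⟨ *-CS.x∙yz≈y∙xz d c (R - 1ℚ) ⟩
      c * (d * (R - 1ℚ))  ≤⟨ *-monoˡ-≤-nonNeg′ 0≤c saturated ⟩
      c * (d * M)         ∎

  overflow-bound : ∀ P x → All (λ e → density x ≤ density e) P → 1ℚ < sizeOf P + s x →
                   sumOf (excess (density x)) P + density x ≤ valueOf P + v x
  overflow-bound P x above x-overflows = begin
    X + dx                     ≤⟨ +-monoʳ-≤ X dx≤ ⟩
    X + (dx * sizeOf P + v x)  ≡⟨ +-assoc X (dx * sizeOf P) (v x) ⟨
    X + dx * sizeOf P + v x    ≤⟨ +-monoˡ-≤ (v x) (excess+d*size≤valueOf above) ⟩
    valueOf P + v x            ∎
    where
    open ≤-Reasoning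
    dx = density x
    X = sumOf (excess dx) P
    dx≤ : dx ≤ dx * sizeOf P + v x
    dx≤ = begin
      dx                        ≡⟨ *-identityʳ dx ⟨
      dx * 1ℚ                   ≤⟨ *-monoˡ-≤-nonNeg′ (density-nonNeg x) (<⇒≤ x-overflows) ⟩
      dx * (sizeOf P + s x)     ≡⟨ *-distribˡ-+ dx (sizeOf P) (s x) ⟩
      dx * sizeOf P + dx * s x  ≡⟨ cong (dx * sizeOf P +_) (density*s≡v x) ⟩
      dx * sizeOf P + v x       ∎

  competitive-overflow : ∀ {I} P x Q → DensitySorted (P ++ x ∷ Q) → Certificate R I (P ++ x ∷ Q) →
                         sizeOf P ≤ 1ℚ → 1ℚ < sizeOf P + s x → OPT I ≤ c * ALG (P ++ x ∷ Q)
  competitive-overflow {I} P x Q sorted cert P-fits x-overflows with AllPairs-pivot P sorted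
  ... | above , below = by-threshold (threshold ≤? density x)
    where
    open Certificate cert
    open ≤-Reasoning
    B = P ++ x ∷ Q
    ALG≥P : valueOf P ≤ ALG B
    ALG≥P = valueOf≤bestPacking P (++⁺ʳ (x ∷ Q) ⊆-refl) P-fits
    ALG≥x : v x ≤ ALG B
    ALG≥x = subst (_≤ ALG B) (+-identityʳ (v x)) (valueOf≤bestPacking [ x ] (++⁺ˡ P (refl ∷ minimum Q))
      (subst (_≤ 1ℚ) (sym (+-identityʳ (s x))) (s≤1 x)))
    drop-tail : ∀ {d} → density x ≤ d → sumOf (excess d) B + d ≤ sumOf (excess d) P + d
    drop-tail {d} x≤d = +-monoˡ-≤ d (sumOf-++-nonPos (excess d) P
      (All.map (λ {e} e≤x → excess≤0 e (≤-trans e≤x x≤d)) (≤-refl ∷ below)))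
    by-threshold : Dec (threshold ≤ density x) → OPT I ≤ c * ALG B
    by-threshold (yes t≤x) = begin
      OPT I                                     ≤⟨ certificate-OPT≤ cert t≤x ⟩
      sumOf (excess (density x)) B + density x  ≤⟨ drop-tail ≤-refl ⟩
      sumOf (excess (density x)) P + density x  ≤⟨ overflow-bound P x above x-overflows ⟩
      valueOf P + v x                           ≤⟨ p+q≤c*r (≤-trans (v≥0 x) ALG≥x) ALG≥P ALG≥x ⟩
      c * ALG B                                 ∎
    by-threshold (no t≰x) = begin
      OPT I                                   ≤⟨ certificate-OPT≤ cert ≤-refl ⟩
      sumOf (excess threshold) B + threshold  ≤⟨ drop-tail (<⇒≤ x<t) ⟩
      sumOf (excess threshold) P + threshold  ≤⟨ saturated-bound P 0≤threshold saturatedP ⟩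
      c * valueOf P                           ≤⟨ *-monoˡ-≤-nonNeg′ 0≤c ALG≥P ⟩
      c * ALG B                               ∎
      where
      x<t : density x < threshold
      x<t = ≰⇒> t≰x
      saturatedP : threshold * (R - 1ℚ) ≤ threshold * sumOf (denseSize threshold) P
      saturatedP = ≤-trans saturated (*-monoˡ-≤-nonNeg′ 0≤threshold
        (sumOf-++-nonPos (denseSize threshold) P
          (All.map (λ {e} e≤x → denseSize≤0 e (≤-<-trans e≤x x<t)) (≤-refl ∷ below))))

  competitive : ∀ {I B} → DensitySorted B → Certificate R I B → OPT I ≤ c * ALG B
  competitive {I} {B} sorted cert with overflow s 0≤1 B
  ... | fits B-fits = begin
    OPT I                                   ≤⟨ certificate-OPT≤ cert ≤-refl ⟩
    sumOf (excess threshold) B + threshold  ≤⟨ saturated-bound B 0≤threshold saturated ⟩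
    c * valueOf B                           ≤⟨ *-monoˡ-≤-nonNeg′ 0≤c (valueOf≤bestPacking B ⊆-refl B-fits) ⟩
    c * ALG B                               ∎
    where
    open Certificate cert
    open ≤-Reasoning
  ... | overflows P x Q P-fits x-overflows =
    competitive-overflow P x Q sorted cert P-fits x-overflows

2≤ratio : ∀ R (1<R : 1ℚ < R) → 1ℚ + 1ℚ ≤ ratio R 1<R
2≤ratio R 1<R = p≤q⊔p ((1/ (R - 1ℚ)) {{>-nonZero (R-1>0 1<R)}}) (1ℚ + 1ℚ)

1≤ratio*[R-1] : ∀ R (1<R : 1ℚ < R) → 1ℚ ≤ ratio R 1<R * (R - 1ℚ)
1≤ratio*[R-1] R 1<R =
  subst (_≤ ratio R 1<R * (R - 1ℚ)) (*-inverseˡ (R - 1ℚ) {{>-nonZero 0<R-1}})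
    (*-monoʳ-≤-nonNeg′ (<⇒≤ 0<R-1) (p≤p⊔q ((1/ (R - 1ℚ)) {{>-nonZero 0<R-1}}) (1ℚ + 1ℚ)))
  where
  0<R-1 : 0ℚ < R - 1ℚ
  0<R-1 = R-1>0 1<R

theorem9 : (R : ℚ) (1<R : 1ℚ < R) → R < 1ℚ + 1ℚ →
    (I Bn : List Item) → Run R I Bn →
    OPT I ≤ ratio R 1<R * ALG Bn
theorem9 R 1<R _ I Bn run =
  Competitive.competitive (2≤ratio R 1<R) (1≤ratio*[R-1] R 1<R) (run-sorted run) (certificate-run 1<R run)
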